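{- Let $M$ be an $N\times N$ square matrix whose diagonal entries are all different from its off-diagonal entries. Then every cell of the pattern $\Pi(SymSqr(M))$ is a union of orbits of $Aut(M)$ acting on locations; that is, two locations in the same orbit lie in the same cell of $\Pi(SymSqr(M))$.
   Context: Pattern: $\Pi(X)$ is the partition of $\{1,\dots,N\}^2$ with $(i,j),(r,s)$ in the same cell iff $X_{i,j}=X_{r,s}$. $Aut(M)$ is the group of permutations $\pi$ of $\{1,\dots,N\}$ with $M_{\pi(i),\pi(j)}=M_{i,j}$ for all $i,j$, acting on locations by $(i,j)\mapsto(\pi(i),\pi(j))$. Canonical inner product string at $(i,j)$: the terms are the ordered pairs $(M_{i,k},M_{k,j})$, $k=1,\dots,N$; list first the terms involving a diagonal entry (if $i\ne j$: $(M_{i,i},M_{i,j})$ then $(M_{i,j},M_{j,j})$; if $i=j$: $(M_{i,i},M_{i,i})$), then the remaining terms sorted lexicographically. $SymSqr(M)$ is the $N\times N$ array whose $(i,j)$ and $(j,i)$ entries both equal the lexicographically lesser of the canonical strings at $(i,j)$ and $(j,i)$. -}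

module Defs where

open import Level using (0ℓ)
open import Data.Nat using (ℕ)
open import Data.Fin using (Fin; _≟_)
open import Data.Fin.Permutation using (Permutation′; _⟨$⟩ʳ_)
open import Data.Bool using (Bool; true; false; if_then_else_)
open import Data.List using (List; []; _∷_; allFin; filter)
open import Data.Product using (_×_; _,_; ∃)
open import Relation.Nullary using (¬_; ¬?; does)
open import Relation.Binary.Core using (Rel)
open import Relation.Binary.Definitions using (Tri; tri<; tri≈; tri>)
open import Relation.Binary.Structures using (IsStrictTotalOrder)
open import Relation.Binary.PropositionalEquality using (_≡_)

Matrix : Set → ℕ → Set
Matrix A N = Fin N → Fin N → A

-- Pattern Π(X): (i,j) and (r,s) lie in the same cell iff X i j ≡ X r s.
SameCell : {B : Set} {N : ℕ} → Matrix B N → (Fin N × Fin N) → (Fin N × Fin N) → Set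
SameCell X (i , j) (r , s) = X i j ≡ X r s

IsAut : {A : Set} {N : ℕ} → Matrix A N → Permutation′ N → Set
IsAut {N = N} M π = (i j : Fin N) → M (π ⟨$⟩ʳ i) (π ⟨$⟩ʳ j) ≡ M i j

act : {N : ℕ} → Permutation′ N → (Fin N × Fin N) → (Fin N × Fin N)
act π (i , j) = (π ⟨$⟩ʳ i , π ⟨$⟩ʳ j)

SameOrbit : {A : Set} {N : ℕ} → Matrix A N → (Fin N × Fin N) → (Fin N × Fin N) → Set
SameOrbit M p q = ∃ λ π → IsAut M π × act π p ≡ q

DiagDistinct : {A : Set} {N : ℕ} → Matrix A N → Set
DiagDistinct {N = N} M = (k i j : Fin N) → ¬ (i ≡ j) → ¬ (M k k ≡ M i j)

module _ {A : Set} (_<_ : Rel A 0ℓ) (sto : IsStrictTotalOrder _≡_ _<_) where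

  private
    cmp = IsStrictTotalOrder.compare sto

  ltA : A → A → Bool
  ltA a b with cmp a b
  ... | tri< _ _ _ = true
  ... | tri≈ _ _ _ = false
  ... | tri> _ _ _ = false

  eqA : A → A → Bool
  eqA a b with cmp a b
  ... | tri< _ _ _ = false
  ... | tri≈ _ _ _ = true
  ... | tri> _ _ _ = false

  ltPair : A × A → A × A → Bool
  ltPair (a , b) (c , d) = if ltA a c then true else (if eqA a c then ltA b d else false)

  insert : A × A → List (A × A) → List (A × A)
  insert x [] = x ∷ []
  insert x (y ∷ ys) = if ltPair y x then y ∷ insert x ys else x ∷ y ∷ ys

  sortPairs : List (A × A) → List (A × A)
  sortPairs [] = []
  sortPairs (x ∷ xs) = insert x (sortPairs xs)

  ltString : List (A × A) → List (A × A) → Bool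
  ltString [] [] = false
  ltString [] (_ ∷ _) = true
  ltString (_ ∷ _) [] = false
  ltString (x ∷ xs) (y ∷ ys) =
    if ltPair x y then true else (if ltPair y x then false else ltString xs ys)

  minString : List (A × A) → List (A × A) → List (A × A)
  minString s t = if ltString t s then t else s

  module _ {N : ℕ} (M : Matrix A N) where

    term : Fin N → Fin N → Fin N → A × A
    term i j k = (M i k , M k j)

    mapTerm : Fin N → Fin N → List (Fin N) → List (A × A)
    mapTerm i j [] = []
    mapTerm i j (k ∷ ks) = term i j k ∷ mapTerm i j ks

    -- canonical inner product string at (i,j)
    canon : Fin N → Fin N → List (A × A)
    canon i j with does (i ≟ j)
    ... | true  = (M i i , M i i)
                    ∷ sortPairs (mapTerm i j (filter (λ k → ¬? (k ≟ i)) (allFin N)))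
    ... | false = (M i i , M i j) ∷ (M i j , M j j)
                    ∷ sortPairs (mapTerm i j
                         (filter (λ k → ¬? (k ≟ j)) (filter (λ k → ¬? (k ≟ i)) (allFin N))))

    SymSqr : Matrix (List (A × A)) N
    SymSqr i j = minString (canon i j) (canon j i)

-- An automorphism π reindexes the inner product at (π i, π j) by k ↦ π k: the
-- terms (M (π i) (π k), M (π k) (π j)) are exactly the terms (M i k, M k j), and
-- π maps the indices outside {i, j} bijectively onto those outside {π i, π j}.
-- The two leading diagonal terms are preserved entry by entry, and the rest is
-- sorted, so it depends only on the multiset of terms. Hence canon (π i) (π j)
-- equals canon i j, and SymSqr is constant on orbits. The hypothesis that
-- diagonal and off-diagonal entries differ is not needed.
module Submission where

open import Defs
open import Level using (0ℓ)
open import Data.Nat using (ℕ)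
open import Data.Fin using (Fin; _≟_)
open import Data.Fin.Permutation using (Permutation′; _⟨$⟩ʳ_; _⟨$⟩ˡ_; inverseʳ)
open import Data.Bool using (true; false; _∧_; _∨_)
open import Data.Sum using (inj₁; inj₂)
open import Data.Product using (_×_; _,_)
open import Data.Product.Relation.Binary.Lex.Strict using (×-Lex; ×-strictTotalOrder)
open import Data.Product.Relation.Binary.Pointwise.NonDependent using (≡×≡⇒≡)
open import Data.List using (List; []; _∷_; map; filter; allFin)
open import Data.List.Properties using (filter-≐)
open import Data.List.Membership.Propositional using (_∈_)
open import Data.List.Membership.Propositional.Properties using (∈-allFin; ∈-map⁺)
open import Data.List.Membership.Propositional.Properties.WithK using (unique∧set⇒bag)
import Data.List.Relation.Unary.Unique.Propositional.Properties as Unique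
open import Data.List.Relation.Unary.Sorted.TotalOrder.Properties using (↗↭↗⇒≋)
open import Data.List.Relation.Binary.Pointwise as Pointwise using (Pointwise-≡⇒≡)
open import Data.List.Relation.Binary.BagAndSetEquality using (∼bag⇒↭)
open import Data.List.Relation.Binary.Permutation.Propositional
  using (_↭_; ↭-sym; ↭-trans; ↭-reflexive; ↭⇒↭ₛ′)
open import Data.List.Relation.Binary.Permutation.Propositional.Properties
  using (map⁺; filter-↭)
import Data.List.Sort.InsertionSort as InsertionSort
import Data.List.Sort.InsertionSort.Properties as InsertionSortProperties
open import Function using (_∘_)
open import Function.Bundles using (Injection; mk⇔)
open import Function.Properties.Inverse using (↔⇒↣)
open import Relation.Nullary using (¬_; ¬?; yes; no; contradiction)
open import Relation.Nullary.Decidable using (dec-true; dec-false)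
open import Relation.Nullary.Reflects using (Reflects; ofʸ; ofⁿ; _⊎-reflects_; _×-reflects_)
open import Relation.Unary using (Pred; Decidable)
open import Relation.Binary.Bundles using (StrictTotalOrder)
open import Relation.Binary.Core using (Rel)
open import Relation.Binary.Definitions using (tri<; tri≈; tri>)
open import Relation.Binary.Structures using (IsStrictTotalOrder)
import Relation.Binary.Properties.StrictTotalOrder as StrictTotalOrderProperties
open import Relation.Binary.PropositionalEquality
  using (_≡_; refl; sym; trans; cong; cong₂; subst; module ≡-Reasoning)

filter-map : ∀ {a b p} {A : Set a} {B : Set b} {P : Pred B p} (P? : Decidable P)
             (f : A → B) (xs : List A) →
             filter P? (map f xs) ≡ map f (filter (P? ∘ f) xs)
filter-map P? f [] = refl
filter-map P? f (x ∷ xs) with P? (f x)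
... | yes _ = cong (f x ∷_) (filter-map P? f xs)
... | no _  = filter-map P? f xs

module LexicographicSort {A : Set} (_<_ : Rel A 0ℓ) (sto : IsStrictTotalOrder _≡_ _<_) where

  open IsStrictTotalOrder sto using (compare)

  ltA-reflects : ∀ a b → Reflects (a < b) (ltA _<_ sto a b)
  ltA-reflects a b with compare a b
  ... | tri< a<b _ _ = ofʸ a<b
  ... | tri≈ a≮b _ _ = ofⁿ a≮b
  ... | tri> a≮b _ _ = ofⁿ a≮b

  eqA-reflects : ∀ a b → Reflects (a ≡ b) (eqA _<_ sto a b)
  eqA-reflects a b with compare a b
  ... | tri< _ a≢b _ = ofⁿ a≢b
  ... | tri≈ _ a≡b _ = ofʸ a≡b
  ... | tri> _ a≢b _ = ofⁿ a≢b

  _<ₗ_ : Rel (A × A) 0ℓ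
  _<ₗ_ = ×-Lex _≡_ _<_ _<_

  ltPair-reflects : ∀ x y → Reflects (x <ₗ y) (ltPair _<_ sto x y)
  ltPair-reflects (a , b) (c , d) =
    subst (Reflects _) ltPair-as-∨
      (ltA-reflects a c ⊎-reflects (eqA-reflects a c ×-reflects ltA-reflects b d))
    where
    ltPair-as-∨ : ltA _<_ sto a c ∨ (eqA _<_ sto a c ∧ ltA _<_ sto b d)
                ≡ ltPair _<_ sto (a , b) (c , d)
    ltPair-as-∨ with ltA _<_ sto a c | eqA _<_ sto a c
    ... | true  | _     = refl
    ... | false | true  = refl
    ... | false | false = refl

  strictTotalOrderₗ : StrictTotalOrder 0ℓ 0ℓ 0ℓ
  strictTotalOrderₗ = ×-strictTotalOrder strictTotalOrder strictTotalOrder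
    where
    strictTotalOrder : StrictTotalOrder 0ℓ 0ℓ 0ℓ
    strictTotalOrder = record { isStrictTotalOrder = sto }

  open StrictTotalOrder strictTotalOrderₗ using (asym; irrefl; module Eq)
    renaming (compare to compareₗ)
  open StrictTotalOrderProperties strictTotalOrderₗ using (decTotalOrder; totalOrder; _≤_; _≤?_)
  module Sort = InsertionSort decTotalOrder
  open InsertionSortProperties decTotalOrder using (sort-↗; sort-↭)

  >ₗ⇒≰ : ∀ {x y} → y <ₗ x → ¬ (x ≤ y)
  >ₗ⇒≰ y<x (inj₁ x<y) = asym y<x x<y
  >ₗ⇒≰ y<x (inj₂ x≈y) = irrefl (Eq.sym x≈y) y<x

  ≯ₗ⇒≤ : ∀ {x y} → ¬ (y <ₗ x) → x ≤ y
  ≯ₗ⇒≤ {x} {y} y≮x with compareₗ x y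
  ... | tri< x<y _ _ = inj₁ x<y
  ... | tri≈ _ x≈y _ = inj₂ x≈y
  ... | tri> _ _ y<x = contradiction y<x y≮x

  -- sortPairs is the library's insertion sort for the non-strict lexicographic
  -- order, so two permutations of each other sort to pointwise equal lists.
  insert≡Sort-insert : ∀ x ys → insert _<_ sto x ys ≡ Sort.insert x ys
  insert≡Sort-insert x [] = refl
  insert≡Sort-insert x (y ∷ ys) with ltPair _<_ sto y x | ltPair-reflects y x
  ... | true  | ofʸ y<x rewrite dec-false (x ≤? y) (>ₗ⇒≰ y<x) = cong (y ∷_) (insert≡Sort-insert x ys)
  ... | false | ofⁿ y≮x rewrite dec-true (x ≤? y) (≯ₗ⇒≤ y≮x) = refl

  sortPairs≡Sort-sort : ∀ xs → sortPairs _<_ sto xs ≡ Sort.sort xs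
  sortPairs≡Sort-sort [] = refl
  sortPairs≡Sort-sort (x ∷ xs) =
    trans (insert≡Sort-insert x (sortPairs _<_ sto xs)) (cong (Sort.insert x) (sortPairs≡Sort-sort xs))

  Sort-sort-↭ : ∀ {xs ys} → xs ↭ ys → Sort.sort xs ≡ Sort.sort ys
  Sort-sort-↭ {xs} {ys} xs↭ys = Pointwise-≡⇒≡ (Pointwise.map ≡×≡⇒≡
    (↗↭↗⇒≋ totalOrder (sort-↗ xs) (sort-↗ ys)
      (↭⇒↭ₛ′ Eq.isEquivalence (↭-trans (sort-↭ xs) (↭-trans xs↭ys (↭-sym (sort-↭ ys)))))))

  sortPairs-↭ : ∀ {xs ys} → xs ↭ ys → sortPairs _<_ sto xs ≡ sortPairs _<_ sto ys
  sortPairs-↭ {xs} {ys} xs↭ys = begin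
    sortPairs _<_ sto xs  ≡⟨ sortPairs≡Sort-sort xs ⟩
    Sort.sort xs          ≡⟨ Sort-sort-↭ xs↭ys ⟩
    Sort.sort ys          ≡⟨ sortPairs≡Sort-sort ys ⟨
    sortPairs _<_ sto ys  ∎
    where open ≡-Reasoning

omit : {N : ℕ} → Fin N → List (Fin N) → List (Fin N)
omit i = filter (λ k → ¬? (k ≟ i))

module Reindexing {N : ℕ} (π : Permutation′ N) where

  σ : Fin N → Fin N
  σ = π ⟨$⟩ʳ_

  σ-injective : ∀ {i j} → σ i ≡ σ j → i ≡ j
  σ-injective = Injection.injective (↔⇒↣ π)

  map-allFin-↭ : map σ (allFin N) ↭ allFin N
  map-allFin-↭ = ∼bag⇒↭ (unique∧set⇒bag
    (Unique.map⁺ σ-injective (Unique.allFin⁺ N)) (Unique.allFin⁺ N)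
    (mk⇔ (λ _ → ∈-allFin _) (λ _ → ∈-map-σ _)))
    where
    ∈-map-σ : ∀ k → k ∈ map σ (allFin N)
    ∈-map-σ k = subst (_∈ map σ (allFin N)) (inverseʳ π) (∈-map⁺ σ (∈-allFin (π ⟨$⟩ˡ k)))

  omit-map : ∀ i xs → omit (σ i) (map σ xs) ≡ map σ (omit i xs)
  omit-map i xs =
    trans (filter-map _ σ xs)
          (cong (map σ) (filter-≐ _ _ ((_∘ cong σ) , (_∘ σ-injective)) xs))

  omit-↭ : ∀ i {xs ys} → xs ↭ map σ ys → omit (σ i) xs ↭ map σ (omit i ys)
  omit-↭ i {ys = ys} xs↭σys = ↭-trans (filter-↭ _ xs↭σys) (↭-reflexive (omit-map i ys))

module _ {A : Set} (_<_ : Rel A 0ℓ) (sto : IsStrictTotalOrder _≡_ _<_) {N : ℕ} (M : Matrix A N) where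

  open LexicographicSort _<_ sto using (sortPairs-↭)

  mapTerm≡map : ∀ i j ks → mapTerm _<_ sto M i j ks ≡ map (term _<_ sto M i j) ks
  mapTerm≡map i j [] = refl
  mapTerm≡map i j (k ∷ ks) = cong (_ ∷_) (mapTerm≡map i j ks)

  mapTerm-↭ : ∀ i j {ks ls} → ks ↭ ls → mapTerm _<_ sto M i j ks ↭ mapTerm _<_ sto M i j ls
  mapTerm-↭ i j {ks} {ls} ks↭ls
    rewrite mapTerm≡map i j ks | mapTerm≡map i j ls = map⁺ _ ks↭ls

  module _ (π : Permutation′ N) (aut : IsAut M π) where

    open Reindexing π

    mapTerm-reindex : ∀ i j ks → mapTerm _<_ sto M (σ i) (σ j) (map σ ks) ≡ mapTerm _<_ sto M i j ks
    mapTerm-reindex i j [] = refl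
    mapTerm-reindex i j (k ∷ ks) = cong₂ _∷_ (cong₂ _,_ (aut i k) (aut k j)) (mapTerm-reindex i j ks)

    sortedTerms-reindex : ∀ i j {ks ls} → ks ↭ map σ ls →
      sortPairs _<_ sto (mapTerm _<_ sto M (σ i) (σ j) ks) ≡ sortPairs _<_ sto (mapTerm _<_ sto M i j ls)
    sortedTerms-reindex i j {ks} {ls} ks↭σls =
      trans (sortPairs-↭ (mapTerm-↭ (σ i) (σ j) ks↭σls)) (cong (sortPairs _<_ sto) (mapTerm-reindex i j ls))

    canon-reindex : ∀ i j → canon _<_ sto M (σ i) (σ j) ≡ canon _<_ sto M i j
    canon-reindex i j with i ≟ j | σ i ≟ σ j
    ... | yes refl | yes _ =
      cong₂ _∷_ (cong₂ _,_ (aut i i) (aut i i))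
        (sortedTerms-reindex i i (omit-↭ i (↭-sym map-allFin-↭)))
    ... | yes refl | no σi≢σi = contradiction refl σi≢σi
    ... | no i≢j   | yes σi≡σj = contradiction (σ-injective σi≡σj) i≢j
    ... | no _     | no _ =
      cong₂ _∷_ (cong₂ _,_ (aut i i) (aut i j)) (cong₂ _∷_ (cong₂ _,_ (aut i j) (aut j j))
        (sortedTerms-reindex i j (omit-↭ j (omit-↭ i (↭-sym map-allFin-↭)))))

    SymSqr-reindex : ∀ i j → SymSqr _<_ sto M (σ i) (σ j) ≡ SymSqr _<_ sto M i j
    SymSqr-reindex i j = cong₂ (minString _<_ sto) (canon-reindex i j) (canon-reindex j i)

theorem11 : {A : Set} (_<_ : Rel A 0ℓ) (sto : IsStrictTotalOrder _≡_ _<_)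
    {N : ℕ} (M : Matrix A N) → DiagDistinct M →
    (p q : Fin N × Fin N) → SameOrbit M p q →
    SameCell (SymSqr _<_ sto M) p q
theorem11 _<_ sto M _ (i , j) _ (π , aut , refl) = sym (SymSqr-reindex _<_ sto M π aut i j)
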